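{- Let $m$ be a positive integer and $S$ a Cayley subset of $Q_{4m}=\langle x,y\mid x^{2m}=1,\ x^m=y^2,\ y^{ -1}xy=x^{ -1}\rangle$. Let $l=l(S)=4m-|S|$, $l_1=2m-|S\cap\langle x\rangle|$, $l_2=2m-|S\cap \langle x\rangle y|$ (so $l=l_1+l_2$), let $\delta=1$ if $x^m\in S$ and $\delta=0$ otherwise, and let $\sigma^{\mathrm e}_1,\sigma^{\mathrm o}_1,\sigma^{\mathrm e}_2,\sigma^{\mathrm o}_2$ and $\lambda_1,\dots,\lambda_4$ be as in the context. Then $\lambda_1=4m-l$ and $\lambda_2=-l+2l_2$. Moreover: (1) if $m$ is odd and (i) $l$ is odd, then $-(l-l_2)\le\lambda_3=\lambda_4\le l-l_2-2$, and $|\lambda_3|=|\lambda_4|$ takes the maximum value $l-l_2$ if and only if $(\sigma^{\mathrm e}_1,\sigma^{\mathrm o}_1)=\bigl(\frac{m+1}{2}-\frac{l-l_2+1}{2},\frac{m-1}{2}\bigr)$; (ii) $l$ is even, then $-(l-l_2-2)\le\lambda_3=\lambda_4\le l-l_2-2$, and $|\lambda_3|=|\lambda_4|$ takes the maximum value $l-l_2-2$ if and only if $(\sigma^{\mathrm e}_1,\sigma^{\mathrm o}_1)=\bigl(\frac{m+1}{2}-\frac{l-l_2}{2},\frac{m-1}{2}\bigr)$ or $\bigl(\frac{m-1}{2},\frac{m+1}{2}-\frac{l-l_2}{2}\bigr)$; (2) if $m$ is even, then $-l\le\lambda_3\le l+2\delta-4$ and $-l\le\lambda_4\le l+2\delta-4$;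 $|\lambda_3|$ takes the maximum value $l$ if and only if $(\sigma^{\mathrm e}_1,\sigma^{\mathrm o}_1)=\bigl(\frac m2-\frac{l-l_2+\delta}{2},\frac m2\bigr)$ and $(\sigma^{\mathrm e}_2,\sigma^{\mathrm o}_2)=\bigl(\frac m2-\frac{l_2}{2},\frac m2\bigr)$; and $|\lambda_4|$ takes the maximum value $l$ if and only if $(\sigma^{\mathrm e}_1,\sigma^{\mathrm o}_1)=\bigl(\frac m2-\frac{l-l_2+\delta}{2},\frac m2\bigr)$ and $(\sigma^{\mathrm e}_2,\sigma^{\mathrm o}_2)=\bigl(\frac m2,\frac m2-\frac{l_2}{2}\bigr)$.
   Context: A Cayley subset of a finite group is a symmetric generating subset not containing the identity. $\langle x\rangle=\{x^k:0\le k\le 2m-1\}$, $\langle x\rangle y=\{x^ky:0\le k\le 2m-1\}$. $\sigma^{\mathrm e}_1$ (resp. $\sigma^{\mathrm o}_1$) is the number of even (resp. odd) integers $k_1$ with $1\le k_1\le m-1$ and $x^{k_1}\in S$; $\sigma^{\mathrm e}_2$ (resp. $\sigma^{\mathrm o}_2$) is the number of even (resp. odd) integers $k_2$ with $0\le k_2\le m-1$ and $x^{k_2}y\in S$. The numbers $\lambda_i$ are: $\lambda_1=2(\sigma^{\mathrm e}_1+\sigma^{\mathrm o}_1)+\delta+2(\sigma^{\mathrm e}_2+\sigma^{\mathrm o}_2)$, $\lambda_2=2(\sigma^{\mathrm e}_1+\sigma^{\mathrm o}_1)+\delta-2(\sigma^{\mathrm e}_2+\sigma^{\mathrm o}_2)$;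 if $m$ is odd, $\lambda_3=\lambda_4=2(\sigma^{\mathrm e}_1-\sigma^{\mathrm o}_1)-\delta$; if $m$ is even, $\lambda_3=2(\sigma^{\mathrm e}_1-\sigma^{\mathrm o}_1)+\delta+2(\sigma^{\mathrm e}_2-\sigma^{\mathrm o}_2)$ and $\lambda_4=2(\sigma^{\mathrm e}_1-\sigma^{\mathrm o}_1)+\delta-2(\sigma^{\mathrm e}_2-\sigma^{\mathrm o}_2)$. (These are the eigenvalues of the Cayley graph $X(S)$ coming from the four one-dimensional representations of $Q_{4m}$.) -}

module Defs where

open import Data.Bool using (Bool; true; false; if_then_else_; _∧_)
open import Data.Nat using (ℕ; zero; suc; _+_; _*_; _∸_; NonZero)
open import Data.Nat.Properties using (m*n≢0)
open import Data.Nat.DivMod using (_mod_)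
open import Data.Fin using (Fin; toℕ)
open import Data.List using (List; []; _∷_; map; upTo; allFin; filterᵇ; length; foldr; _++_)
open import Data.List.Relation.Unary.All using (All)
open import Data.Product using (∃; _×_)
open import Data.Integer as ℤ using (ℤ; +_)
open import Relation.Binary.PropositionalEquality using (_≡_)

isEven : ℕ → Bool
isEven zero = true
isEven (suc n) with isEven n
... | true = false
... | false = true

-- Elements of the generalized quaternion (dicyclic) group Q_{4m}:
-- ⟨ e , k ⟩ stands for x^k y^e  (e = false : y^0, e = true : y^1), 0 ≤ k < 2m.
record Q (m : ℕ) : Set where
  constructor ⟨_,_⟩
  field
    e : Bool
    k : Fin (2 * m)

module _ {m : ℕ} .{{_ : NonZero m}} where

  private
    instance
      nz2m : NonZero (2 * m)
      nz2m = m*n≢0 2 m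

  md : ℕ → Fin (2 * m)
  md a = a mod (2 * m)

  xpow : ℕ → Q m
  xpow a = ⟨ false , md a ⟩

  xpowy : ℕ → Q m
  xpowy a = ⟨ true , md a ⟩

  one : Q m
  one = xpow 0

  -- multiplication, using y x = x⁻¹ y and y² = x^m:
  --   x^a · x^b = x^(a+b),   x^a · x^b y = x^(a+b) y,
  --   x^a y · x^b = x^(a-b) y,   x^a y · x^b y = x^(a-b+m)
  _·_ : Q m → Q m → Q m
  ⟨ false , a ⟩ · ⟨ false , b ⟩ = xpow  (toℕ a + toℕ b)
  ⟨ false , a ⟩ · ⟨ true  , b ⟩ = xpowy (toℕ a + toℕ b)
  ⟨ true  , a ⟩ · ⟨ false , b ⟩ = xpowy (toℕ a + (2 * m ∸ toℕ b))
  ⟨ true  , a ⟩ · ⟨ true  , b ⟩ = xpow  (toℕ a + (2 * m ∸ toℕ b) + m)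

  inv : Q m → Q m
  inv ⟨ false , a ⟩ = xpow  (2 * m ∸ toℕ a)
  inv ⟨ true  , a ⟩ = xpowy (toℕ a + m)

  allQ : List (Q m)
  allQ = map ⟨ false ,_⟩ (allFin (2 * m)) ++ map ⟨ true ,_⟩ (allFin (2 * m))

  Subset : Set
  Subset = Q m → Bool

  record IsCayley (S : Subset) : Set where
    field
      no-identity : S one ≡ false
      symmetric   : ∀ g → S g ≡ true → S (inv g) ≡ true
      generating  : ∀ g → ∃ λ (ws : List (Q m)) →
                      All (λ s → S s ≡ true) ws × foldr _·_ one ws ≡ g

  module _ (S : Subset) where

    cardS : ℕ
    cardS = length (filterᵇ S allQ)

    cardSx : ℕ
    cardSx = length (filterᵇ S (map xpow (upTo (2 * m))))

    cardSxy : ℕ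
    cardSxy = length (filterᵇ S (map xpowy (upTo (2 * m))))

    l l₁ l₂ : ℕ
    l  = 4 * m ∸ cardS
    l₁ = 2 * m ∸ cardSx
    l₂ = 2 * m ∸ cardSxy

    δ : ℕ
    δ = if S (xpow m) then 1 else 0

    private
      isOdd : ℕ → Bool
      isOdd k = if isEven k then false else true
      range₁ range₂ : List ℕ
      range₁ = map suc (upTo (m ∸ 1))
      range₂ = upTo m

    σe₁ σo₁ σe₂ σo₂ : ℕ
    σe₁ = length (filterᵇ (λ k → isEven k ∧ S (xpow k)) range₁)
    σo₁ = length (filterᵇ (λ k → isOdd k ∧ S (xpow k)) range₁)
    σe₂ = length (filterᵇ (λ k → isEven k ∧ S (xpowy k)) range₂)
    σo₂ = length (filterᵇ (λ k → isOdd k ∧ S (xpowy k)) range₂)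

    private
      z : ℕ → ℤ
      z = +_

    λ₁ λ₂ λ₃ λ₄ : ℤ
    λ₁ = z 2 ℤ.* (z σe₁ ℤ.+ z σo₁) ℤ.+ z δ ℤ.+ z 2 ℤ.* (z σe₂ ℤ.+ z σo₂)
    λ₂ = z 2 ℤ.* (z σe₁ ℤ.+ z σo₁) ℤ.+ z δ ℤ.- z 2 ℤ.* (z σe₂ ℤ.+ z σo₂)
    λ₃ = if isEven m
         then z 2 ℤ.* (z σe₁ ℤ.- z σo₁) ℤ.+ z δ ℤ.+ z 2 ℤ.* (z σe₂ ℤ.- z σo₂)
         else z 2 ℤ.* (z σe₁ ℤ.- z σo₁) ℤ.- z δ
    λ₄ = if isEven m
         then z 2 ℤ.* (z σe₁ ℤ.- z σo₁) ℤ.+ z δ ℤ.- z 2 ℤ.* (z σe₂ ℤ.- z σo₂)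
         else z 2 ℤ.* (z σe₁ ℤ.- z σo₁) ℤ.- z δ

module Submission where

-- Symmetry of S pairs x^k with x^(2m-k) and x^k y with x^(k+m) y, so |S ∩ ⟨x⟩| = δ + 2(σe₁ + σo₁)
-- and |S ∩ ⟨x⟩y| = 2(σe₂ + σo₂); hence l and l₂ are linear in δ and the σ's, which gives λ₁, λ₂
-- and l ≡ δ (mod 2).  Each σ counts a set of even or odd numbers in its range, so σe₁ ≤ ⌈m/2⌉ - 1,
-- σo₁ ≤ ⌊m/2⌋, σe₂ ≤ ⌈m/2⌉ and σo₂ ≤ ⌊m/2⌋.  Writing every σ as its maximum minus a slack,
-- l + λᵢ and (upper bound) - λᵢ become nonnegative combinations of slacks: this gives the bounds,
-- and |λᵢ| attains its bound exactly when the relevant slacks vanish, which is what the stated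
-- values of the σ's express.

open import Defs
open import Data.Bool using (Bool; true; false)
open import Data.Nat using (ℕ; suc)

module Counting where

  open import Data.Bool using (_∧_; if_then_else_)
  open import Data.Nat
  open import Data.Nat.Properties
  open import Data.Fin using (Fin; toℕ)
  import Data.Fin as Fin
  open import Data.List using (length; filterᵇ; applyUpTo; tabulate; map; upTo; _∷_)
  open import Data.List.Properties using (map-upTo)
  open import Data.Product using (_×_; _,_)
  open import Function using (_∘_)
  open import Algebra.Properties.CommutativeSemigroup +-commutativeSemigroup using (interchange)
  open import Relation.Binary.PropositionalEquality

  -- Both are written exactly as in Defs (the parity test of σo₁, σo₂ and the definition of δ),
  -- so that those quantities unfold to them definitionally.
  isOdd : ℕ → Bool
  isOdd k = if isEven k then false else true

  indicator : Bool → ℕ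
  indicator b = if b then 1 else 0

  indicator≤1 : ∀ b → indicator b ≤ 1
  indicator≤1 true  = ≤-refl
  indicator≤1 false = z≤n

  count : (ℕ → Bool) → ℕ → ℕ
  count p zero    = 0
  count p (suc n) = indicator (p 0) + count (p ∘ suc) n

  module _ {A : Set} (p : A → Bool) where

    length-filterᵇ-∷ : ∀ x xs → length (filterᵇ p (x ∷ xs)) ≡ indicator (p x) + length (filterᵇ p xs)
    length-filterᵇ-∷ x xs with p x
    ... | true  = refl
    ... | false = refl

    length-filterᵇ-applyUpTo : ∀ f n → length (filterᵇ p (applyUpTo f n)) ≡ count (p ∘ f) n
    length-filterᵇ-applyUpTo f zero    = refl
    length-filterᵇ-applyUpTo f (suc n) =
      trans (length-filterᵇ-∷ (f 0) _) (cong (indicator (p (f 0)) +_) (length-filterᵇ-applyUpTo (f ∘ suc) n))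

    length-filterᵇ-map-upTo : ∀ f n → length (filterᵇ p (map f (upTo n))) ≡ count (p ∘ f) n
    length-filterᵇ-map-upTo f n = trans (cong (length ∘ filterᵇ p) (map-upTo f n)) (length-filterᵇ-applyUpTo f n)

    length-filterᵇ-tabulate : ∀ {n} (g : Fin n → A) (q : ℕ → Bool) → (∀ i → p (g i) ≡ q (toℕ i)) →
                              length (filterᵇ p (tabulate g)) ≡ count q n
    length-filterᵇ-tabulate {zero}  g q pg≡q = refl
    length-filterᵇ-tabulate {suc n} g q pg≡q = trans (length-filterᵇ-∷ (g Fin.zero) _)
      (cong₂ (λ b c → indicator b + c) (pg≡q Fin.zero)
        (length-filterᵇ-tabulate (g ∘ Fin.suc) (q ∘ suc) (pg≡q ∘ Fin.suc)))

  count-cong : ∀ n {p q} → (∀ k → k < n → p k ≡ q k) → count p n ≡ count q n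
  count-cong zero    p≡q = refl
  count-cong (suc n) p≡q =
    cong₂ (λ b c → indicator b + c) (p≡q 0 z<s) (count-cong n (λ k k<n → p≡q (suc k) (s<s k<n)))

  count≤ : ∀ n p → count p n ≤ n
  count≤ zero    p = z≤n
  count≤ (suc n) p with p 0
  ... | true  = s≤s (count≤ n (p ∘ suc))
  ... | false = m≤n⇒m≤1+n (count≤ n (p ∘ suc))

  count-∧≤ : ∀ n (e r : ℕ → Bool) → count (λ k → e k ∧ r k) n ≤ count e n
  count-∧≤ zero    e r = z≤n
  count-∧≤ (suc n) e r = +-mono-≤ (indicator-∧≤ (e 0) (r 0)) (count-∧≤ n (e ∘ suc) (r ∘ suc))
    where
    indicator-∧≤ : ∀ a b → indicator (a ∧ b) ≤ indicator a
    indicator-∧≤ true  true  = ≤-refl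
    indicator-∧≤ true  false = z≤n
    indicator-∧≤ false b     = z≤n

  count-∧-split : ∀ n (e r : ℕ → Bool) →
                  count (λ k → e k ∧ r k) n + count (λ k → (if e k then false else true) ∧ r k) n ≡ count r n
  count-∧-split zero    e r = refl
  count-∧-split (suc n) e r = begin
    (indicator (e 0 ∧ r 0) + evens) + (indicator (ē 0 ∧ r 0) + odds)
      ≡⟨ interchange (indicator (e 0 ∧ r 0)) evens (indicator (ē 0 ∧ r 0)) odds ⟩
    (indicator (e 0 ∧ r 0) + indicator (ē 0 ∧ r 0)) + (evens + odds)
      ≡⟨ cong₂ _+_ (indicator-split (e 0) (r 0)) (count-∧-split n (e ∘ suc) (r ∘ suc)) ⟩
    indicator (r 0) + count (r ∘ suc) n
      ∎
    where
    open ≡-Reasoning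
    ē : ℕ → Bool
    ē k = if e k then false else true
    evens odds : ℕ
    evens = count (λ k → e (suc k) ∧ r (suc k)) n
    odds  = count (λ k → ē (suc k) ∧ r (suc k)) n
    indicator-split : ∀ a b → indicator (a ∧ b) + indicator ((if a then false else true) ∧ b) ≡ indicator b
    indicator-split true  b = +-identityʳ (indicator b)
    indicator-split false b = refl

  count-+ : ∀ a b p → count p (a + b) ≡ count p a + count (λ k → p (a + k)) b
  count-+ zero    b p = refl
  count-+ (suc a) b p =
    trans (cong (indicator (p 0) +_) (count-+ a b (p ∘ suc))) (sym (+-assoc (indicator (p 0)) _ _))

  count-snoc : ∀ n p → count p (suc n) ≡ count p n + indicator (p n)
  count-snoc zero    p = +-comm (indicator (p 0)) 0
  count-snoc (suc n) p =
    trans (cong (indicator (p 0) +_) (count-snoc n (p ∘ suc))) (sym (+-assoc (indicator (p 0)) _ _))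

  count-reverse : ∀ n p → count p n ≡ count (λ k → p (n ∸ suc k)) n
  count-reverse zero    p = refl
  count-reverse (suc n) p = begin
    indicator (p 0) + count (p ∘ suc) n
      ≡⟨ cong (indicator (p 0) +_) (count-reverse n (p ∘ suc)) ⟩
    indicator (p 0) + count (λ k → p (suc (n ∸ suc k))) n
      ≡⟨ cong (indicator (p 0) +_) (count-cong n λ k k<n → cong p (sym (+-∸-assoc 1 k<n))) ⟩
    indicator (p 0) + count (λ k → p (n ∸ k)) n
      ≡⟨ +-comm (indicator (p 0)) _ ⟩
    count (λ k → p (n ∸ k)) n + indicator (p 0)
      ≡⟨ cong (λ j → count (λ k → p (n ∸ k)) n + indicator (p j)) (n∸n≡0 n) ⟨
    count (λ k → p (n ∸ k)) n + indicator (p (n ∸ n))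
      ≡⟨ count-snoc n (λ k → p (n ∸ k)) ⟨
    count (λ k → p (n ∸ k)) (suc n)
      ∎
    where open ≡-Reasoning

  isEven-suc : ∀ n → isEven (suc n) ≡ (if isEven n then false else true)
  isEven-suc n with isEven n
  ... | true  = refl
  ... | false = refl

  isEven-suc-suc : ∀ n → isEven (suc (suc n)) ≡ isEven n
  isEven-suc-suc n with isEven n
  ... | true  = refl
  ... | false = refl

  isEven-+-2* : ∀ n k → isEven (n + 2 * k) ≡ isEven n
  isEven-+-2* n zero    = cong isEven (+-identityʳ n)
  isEven-+-2* n (suc k) = begin
    isEven (n + 2 * suc k)         ≡⟨ cong (λ t → isEven (n + t)) (*-suc 2 k) ⟩
    isEven (n + suc (suc (2 * k))) ≡⟨ cong isEven (trans (+-suc n _) (cong suc (+-suc n _))) ⟩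
    isEven (suc (suc (n + 2 * k))) ≡⟨ isEven-suc-suc (n + 2 * k) ⟩
    isEven (n + 2 * k)             ≡⟨ isEven-+-2* n k ⟩
    isEven n                       ∎
    where open ≡-Reasoning

  indicator-parity : ∀ n b → isEven (n + indicator b) ≡ true → indicator b ≡ (if isEven n then 0 else 1)
  indicator-parity n false even rewrite trans (sym (cong isEven (+-identityʳ n))) even = refl
  indicator-parity n true  even with isEven n in eq
  ... | false = refl
  ... | true  with () ← trans (sym even)
                          (trans (cong isEven (+-comm n 1)) (trans (isEven-suc n) (cong (λ b → if b then false else true) eq)))

  even-halves : ∀ n → isEven n ≡ true → n ≡ ⌊ n /2⌋ + ⌊ n /2⌋ × ⌈ n /2⌉ ≡ ⌊ n /2⌋
  even-halves zero          _    = refl , refl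
  even-halves (suc (suc n)) even with n≡h+h , ⌈⌉≡⌊⌋ ← even-halves n (trans (sym (isEven-suc-suc n)) even) =
    cong suc (trans (cong suc n≡h+h) (sym (+-suc ⌊ n /2⌋ ⌊ n /2⌋))) , cong suc ⌈⌉≡⌊⌋

  odd-halves : ∀ n → isEven n ≡ false → n ≡ suc (⌊ n /2⌋ + ⌊ n /2⌋) × ⌈ n /2⌉ ≡ suc ⌊ n /2⌋
  odd-halves (suc zero)    _   = refl , refl
  odd-halves (suc (suc n)) odd with n≡1+h+h , ⌈⌉≡1+⌊⌋ ← odd-halves n (trans (sym (isEven-suc-suc n)) odd) =
    cong suc (trans (cong suc n≡1+h+h) (cong suc (sym (+-suc ⌊ n /2⌋ ⌊ n /2⌋)))) , cong suc ⌈⌉≡1+⌊⌋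

  count-isEven : ∀ n → count isEven n ≡ ⌈ n /2⌉
  count-isEven zero          = refl
  count-isEven (suc zero)    = refl
  count-isEven (suc (suc n)) = cong suc (trans (count-cong n λ k _ → isEven-suc-suc k) (count-isEven n))

  count-isOdd : ∀ n → count isOdd n ≡ ⌊ n /2⌋
  count-isOdd zero          = refl
  count-isOdd (suc zero)    = refl
  count-isOdd (suc (suc n)) =
    cong suc (trans (count-cong n λ k _ → cong (λ b → if b then false else true) (isEven-suc-suc k)) (count-isOdd n))

module IntegerSlack where

  open import Data.Nat as ℕ using (z≤n)
  import Data.Nat.Properties as ℕ
  open import Data.Integer
  open import Data.Integer.Properties
  open import Data.Integer.Tactic.RingSolver
  open import Data.List using (_∷_; [])
  open import Data.Product using (_×_; _,_)
  open import Data.Sum using (_⊎_; inj₁; inj₂)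
  open import Function.Bundles using (_⇔_; mk⇔; Equivalence)
  open import Function.Properties.Equivalence using () renaming (trans to infixr 5 _⟨⇔⟩_)
  open import Relation.Binary.PropositionalEquality

  +-∸ : ∀ {m n} → n ℕ.≤ m → + (m ℕ.∸ n) ≡ + m - + n
  +-∸ {m} {n} n≤m = trans (sym (⊖-≥ n≤m)) (sym (m-n≡m⊖n m n))

  nonneg-+ : ∀ {U V} → 0ℤ ≤ U → 0ℤ ≤ V → 0ℤ ≤ U + V
  nonneg-+ = +-mono-≤

  nonneg-*ˡ : ∀ k {Q} → 0ℤ ≤ Q → 0ℤ ≤ + k * Q
  nonneg-*ˡ k (+≤+ {n = q} _) = subst (0ℤ ≤_) (pos-* k q) (+≤+ z≤n)

  nonneg-double : ∀ n → 0ℤ ≤ n + n → 0ℤ ≤ n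
  nonneg-double (+ _)    _  = +≤+ z≤n
  nonneg-double -[1+ _ ] ()

  ≤-by-slack : ∀ {x y U} → 0ℤ ≤ U → y - x ≡ U → x ≤ y
  ≤-by-slack 0≤U refl = 0≤i-j⇒j≤i 0≤U

  nonneg-+≡0 : ∀ {U V} → 0ℤ ≤ U → 0ℤ ≤ V → (U + V ≡ 0ℤ) ⇔ (U ≡ 0ℤ × V ≡ 0ℤ)
  nonneg-+≡0 (+≤+ {n = u} _) (+≤+ _) = mk⇔
    (λ e → cong +_ (ℕ.m+n≡0⇒m≡0 u (+-injective e)) , cong +_ (ℕ.m+n≡0⇒n≡0 u (+-injective e)))
    (λ { (refl , refl) → refl })

  ≡⇔multiple≡0 : ∀ {x y} c Q .{{_ : NonZero c}} → x - y ≡ c * Q → (x ≡ y) ⇔ (Q ≡ 0ℤ)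
  ≡⇔multiple≡0 {x} {y} c Q e = mk⇔ to from
    where
    to : x ≡ y → Q ≡ 0ℤ
    to refl = *-cancelˡ-≡ c Q 0ℤ (trans (sym e) (trans (+-inverseʳ x) (sym (*-zeroʳ c))))
    from : Q ≡ 0ℤ → x ≡ y
    from refl = i-j≡0⇒i≡j x y (trans e (*-zeroʳ c))

  *≡0⇔≡0 : ∀ c Q .{{_ : NonZero c}} → (c * Q ≡ 0ℤ) ⇔ (Q ≡ 0ℤ)
  *≡0⇔≡0 c Q = ≡⇔multiple≡0 c Q (+-identityʳ (c * Q))

  ⇔-both : ∀ {R A B : Set} → A ⇔ R → B ⇔ R → R ⇔ (A × B)
  ⇔-both A⇔R B⇔R = mk⇔ (λ r → Equivalence.from A⇔R r , Equivalence.from B⇔R r) (λ (a , _) → Equivalence.to A⇔R a)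

  ∣∣≡⇔slack≡0 : ∀ x n {U V} → 0ℤ ≤ U → 0ℤ ≤ V → n + x ≡ U → n - x ≡ V →
                (+ ∣ x ∣ ≡ n) ⇔ (U ≡ 0ℤ ⊎ V ≡ 0ℤ)
  ∣∣≡⇔slack≡0 x n 0≤U 0≤V refl refl = mk⇔ to from
    where
    0≤n : 0ℤ ≤ n
    0≤n = nonneg-double n (subst (0ℤ ≤_) slacks-sum (nonneg-+ 0≤U 0≤V))
      where
      slacks-sum : (n + x) + (n - x) ≡ n + n
      slacks-sum = solve (n ∷ x ∷ [])
    to : + ∣ x ∣ ≡ n → n + x ≡ 0ℤ ⊎ n - x ≡ 0ℤ
    to ∣x∣≡n with +∣i∣≡i⊎+∣i∣≡-i x
    ... | inj₁ ∣x∣≡x  = inj₂ (trans (cong (_- x) (trans (sym ∣x∣≡n) ∣x∣≡x)) (+-inverseʳ x))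
    ... | inj₂ ∣x∣≡-x = inj₁ (trans (cong (_+ x) (trans (sym ∣x∣≡n) ∣x∣≡-x)) (+-inverseˡ x))
    from : n + x ≡ 0ℤ ⊎ n - x ≡ 0ℤ → + ∣ x ∣ ≡ n
    from (inj₁ n+x≡0) = begin
      + ∣ x ∣     ≡⟨ cong (λ y → + ∣ y ∣) (i-j≡0⇒i≡j x (- n) (trans x--n≡n+x n+x≡0)) ⟩
      + ∣ - n ∣   ≡⟨ cong +_ (∣-i∣≡∣i∣ n) ⟩
      + ∣ n ∣     ≡⟨ 0≤i⇒+∣i∣≡i 0≤n ⟩
      n           ∎
      where
      open ≡-Reasoning
      x--n≡n+x : x - - n ≡ n + x
      x--n≡n+x = solve (n ∷ x ∷ [])
    from (inj₂ n-x≡0) = trans (cong (λ y → + ∣ y ∣) (sym (i-j≡0⇒i≡j n x n-x≡0))) (0≤i⇒+∣i∣≡i 0≤n)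

  ∣∣≡⇔slack≡0′ : ∀ x n {U V} → 0ℤ ≤ U → 0ℤ ≤ V → n + x ≡ U → n - x ≡ + 1 + V →
                 (+ ∣ x ∣ ≡ n) ⇔ (U ≡ 0ℤ)
  ∣∣≡⇔slack≡0′ x n 0≤U 0≤V@(+≤+ _) n+x≡U n-x≡1+V =
    ∣∣≡⇔slack≡0 x n 0≤U (nonneg-+ (+≤+ z≤n) 0≤V) n+x≡U n-x≡1+V
      ⟨⇔⟩ mk⇔ (λ { (inj₁ U≡0) → U≡0 ; (inj₂ ()) }) inj₁

  ∣∣≡⇔slacks≡0 : ∀ x n {U₁ U₂ V} → 0ℤ ≤ U₁ → 0ℤ ≤ U₂ → 0ℤ ≤ V →
                 n + x ≡ + 4 * (U₁ + U₂) → n - x ≡ + 1 + V → (+ ∣ x ∣ ≡ n) ⇔ (U₁ ≡ 0ℤ × U₂ ≡ 0ℤ)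
  ∣∣≡⇔slacks≡0 x n {U₁} {U₂} 0≤U₁ 0≤U₂ 0≤V n+x≡4[U₁+U₂] n-x≡1+V =
    ∣∣≡⇔slack≡0′ x n (nonneg-*ˡ 4 (nonneg-+ 0≤U₁ 0≤U₂)) 0≤V n+x≡4[U₁+U₂] n-x≡1+V
      ⟨⇔⟩ *≡0⇔≡0 (+ 4) (U₁ + U₂)
      ⟨⇔⟩ nonneg-+≡0 0≤U₁ 0≤U₂

module ExtremalValues where

  open import Data.Nat using (z≤n)
  open import Data.Integer
  open import Data.Integer.Tactic.RingSolver
  open import Data.List using (_∷_; [])
  open import Data.Product using (_×_; _,_)
  open import Data.Sum using (_⊎_)
  open import Function.Bundles using (_⇔_)
  open import Function.Properties.Equivalence using () renaming (trans to infixr 5 _⟨⇔⟩_)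
  open import Data.Product.Function.NonDependent.Propositional using (_×-⇔_)
  open import Data.Sum.Function.Propositional using (_⊎-⇔_)
  open import Data.Product.Algebra using (×-assoc)
  open import Function.Properties.Inverse using (↔⇒⇔)
  open import Relation.Binary.PropositionalEquality
  open IntegerSlack

  -- A, B, C, D, Δ, M, L, L₂ stand for σe₁, σo₁, σe₂, σo₂, δ, m, l, l₂; H = ⌊m/2⌋; P, Q, P₁, …, P₄ are
  -- the slacks of the σ's below their maxima; F = 2(σe₁ + σo₁), E = 2(σe₂ + σo₂) and Δ′ = 1 - δ.
  -- Every hypothesis is solved for a variable, so that matching it with refl eliminates that variable;
  -- A, B, C, D, H are explicit since they occur only under ℤ operations, through which Agda cannot infer them.

  λ₁λ₂-values : ∀ F M {E Δ L L₂ : ℤ} →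
    L₂ ≡ + 2 * M - E → L ≡ + 4 * M - (Δ + F + E) →
    (F + Δ + E ≡ + 4 * M - L) × (F + Δ - E ≡ - L + + 2 * L₂)
  λ₁λ₂-values F M {E} {Δ} refl refl = solve (F ∷ E ∷ Δ ∷ M ∷ []) , solve (F ∷ E ∷ Δ ∷ M ∷ [])

  extremes-odd-m-odd-l : ∀ A B H {E P Q Δ M L L₂ x x′ : ℤ} → Δ ≡ + 1 →
    M ≡ + 1 + (H + H) → P ≡ H - A → Q ≡ H - B →
    L₂ ≡ + 2 * M - E → L ≡ + 4 * M - (Δ + + 2 * (A + B) + E) →
    x ≡ + 2 * (A - B) - Δ → x′ ≡ + 2 * (A - B) - Δ → 0ℤ ≤ P → 0ℤ ≤ Q →
    (- (L - L₂) ≤ x) × (x ≡ x′) × (x ≤ L - L₂ - + 2)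
    × ((+ ∣ x ∣ ≡ L - L₂) ⇔ ((+ 2 * A ≡ (M + + 1) - (L - L₂ + + 1)) × (+ 2 * B ≡ M - + 1)))
  extremes-odd-m-odd-l A B H {E} {P} {Q} {Δ} {M} {L} {L₂} {x} refl refl refl refl refl refl refl refl 0≤P 0≤Q =
    ≤-by-slack 0≤4Q (solve (H ∷ A ∷ B ∷ E ∷ [])) , refl ,
    ≤-by-slack 0≤4P (solve (H ∷ A ∷ B ∷ E ∷ [])) ,
    ∣∣≡⇔slack≡0′ x (L - L₂) 0≤4Q (nonneg-+ (+≤+ {n = 1} z≤n) 0≤4P)
        (solve (H ∷ A ∷ B ∷ E ∷ [])) (solve (H ∷ A ∷ B ∷ E ∷ []))
      ⟨⇔⟩ *≡0⇔≡0 (+ 4) Q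
      ⟨⇔⟩ ⇔-both (≡⇔multiple≡0 (+ 2) Q gap-σe₁) (≡⇔multiple≡0 (- + 2) Q gap-σo₁)
    where
    0≤4P : 0ℤ ≤ + 4 * P
    0≤4P = nonneg-*ˡ 4 0≤P
    0≤4Q : 0ℤ ≤ + 4 * Q
    0≤4Q = nonneg-*ˡ 4 0≤Q
    gap-σe₁ : + 2 * A - ((M + + 1) - (L - L₂ + + 1)) ≡ + 2 * Q
    gap-σe₁ = solve (H ∷ A ∷ B ∷ E ∷ [])
    gap-σo₁ : + 2 * B - (M - + 1) ≡ - + 2 * Q
    gap-σo₁ = solve (H ∷ A ∷ B ∷ E ∷ [])

  extremes-odd-m-even-l : ∀ A B H {E P Q Δ M L L₂ x x′ : ℤ} → Δ ≡ 0ℤ →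
    M ≡ + 1 + (H + H) → P ≡ H - A → Q ≡ H - B →
    L₂ ≡ + 2 * M - E → L ≡ + 4 * M - (Δ + + 2 * (A + B) + E) →
    x ≡ + 2 * (A - B) - Δ → x′ ≡ + 2 * (A - B) - Δ → 0ℤ ≤ P → 0ℤ ≤ Q →
    (- (L - L₂ - + 2) ≤ x) × (x ≡ x′) × (x ≤ L - L₂ - + 2)
    × ((+ ∣ x ∣ ≡ L - L₂ - + 2) ⇔ (((+ 2 * A ≡ (M + + 1) - (L - L₂)) × (+ 2 * B ≡ M - + 1))
                                  ⊎ ((+ 2 * A ≡ M - + 1) × (+ 2 * B ≡ (M + + 1) - (L - L₂)))))
  extremes-odd-m-even-l A B H {E} {P} {Q} {Δ} {M} {L} {L₂} {x} refl refl refl refl refl refl refl refl 0≤P 0≤Q =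
    ≤-by-slack 0≤4Q (solve (H ∷ A ∷ B ∷ E ∷ [])) , refl ,
    ≤-by-slack 0≤4P (solve (H ∷ A ∷ B ∷ E ∷ [])) ,
    ∣∣≡⇔slack≡0 x (L - L₂ - + 2) 0≤4Q 0≤4P
        (solve (H ∷ A ∷ B ∷ E ∷ [])) (solve (H ∷ A ∷ B ∷ E ∷ []))
      ⟨⇔⟩ (*≡0⇔≡0 (+ 4) Q ⊎-⇔ *≡0⇔≡0 (+ 4) P)
      ⟨⇔⟩ (⇔-both (≡⇔multiple≡0 (+ 2) Q gap-σe₁) (≡⇔multiple≡0 (- + 2) Q gap-σo₁)
           ⊎-⇔ ⇔-both (≡⇔multiple≡0 (- + 2) P gap-σe₁′) (≡⇔multiple≡0 (+ 2) P gap-σo₁′))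
    where
    0≤4P : 0ℤ ≤ + 4 * P
    0≤4P = nonneg-*ˡ 4 0≤P
    0≤4Q : 0ℤ ≤ + 4 * Q
    0≤4Q = nonneg-*ˡ 4 0≤Q
    gap-σe₁ : + 2 * A - ((M + + 1) - (L - L₂)) ≡ + 2 * Q
    gap-σe₁ = solve (H ∷ A ∷ B ∷ E ∷ [])
    gap-σo₁ : + 2 * B - (M - + 1) ≡ - + 2 * Q
    gap-σo₁ = solve (H ∷ A ∷ B ∷ E ∷ [])
    gap-σe₁′ : + 2 * A - (M - + 1) ≡ - + 2 * P
    gap-σe₁′ = solve (H ∷ A ∷ B ∷ E ∷ [])
    gap-σo₁′ : + 2 * B - ((M + + 1) - (L - L₂)) ≡ + 2 * P
    gap-σo₁′ = solve (H ∷ A ∷ B ∷ E ∷ [])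

  extremes-even-m : ∀ A B C D H {P₁ P₂ P₃ P₄ Δ Δ′ M L L₂ x₃ x₄ : ℤ} →
    Δ′ ≡ + 1 - Δ → M ≡ H + H → P₁ ≡ H - (+ 1 + A) → P₂ ≡ H - B → P₃ ≡ H - C → P₄ ≡ H - D →
    L₂ ≡ + 2 * M - + 2 * (C + D) → L ≡ + 4 * M - (Δ + + 2 * (A + B) + + 2 * (C + D)) →
    x₃ ≡ + 2 * (A - B) + Δ + + 2 * (C - D) → x₄ ≡ + 2 * (A - B) + Δ - + 2 * (C - D) →
    0ℤ ≤ Δ′ → 0ℤ ≤ P₁ → 0ℤ ≤ P₂ → 0ℤ ≤ P₃ → 0ℤ ≤ P₄ →
    (- L ≤ x₃) × (x₃ ≤ L + + 2 * Δ - + 4) × (- L ≤ x₄) × (x₄ ≤ L + + 2 * Δ - + 4)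
    × ((+ ∣ x₃ ∣ ≡ L) ⇔ ((+ 2 * A ≡ M - (L - L₂ + Δ)) × (+ 2 * B ≡ M) × (+ 2 * C ≡ M - L₂) × (+ 2 * D ≡ M)))
    × ((+ ∣ x₄ ∣ ≡ L) ⇔ ((+ 2 * A ≡ M - (L - L₂ + Δ)) × (+ 2 * B ≡ M) × (+ 2 * C ≡ M) × (+ 2 * D ≡ M - L₂)))
  extremes-even-m A B C D H {P₁} {P₂} {P₃} {P₄} {Δ} {Δ′} {M} {L} {L₂} {x₃} {x₄}
       refl refl refl refl refl refl refl refl refl refl 0≤Δ′ 0≤P₁ 0≤P₂ 0≤P₃ 0≤P₄ =
    ≤-by-slack (0≤4[+] 0≤P₂ 0≤P₄) (solve (H ∷ A ∷ B ∷ C ∷ D ∷ Δ ∷ [])) ,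
    ≤-by-slack (0≤4[+] 0≤P₁ 0≤P₃) (solve (H ∷ A ∷ B ∷ C ∷ D ∷ Δ ∷ [])) ,
    ≤-by-slack (0≤4[+] 0≤P₂ 0≤P₃) (solve (H ∷ A ∷ B ∷ C ∷ D ∷ Δ ∷ [])) ,
    ≤-by-slack (0≤4[+] 0≤P₁ 0≤P₄) (solve (H ∷ A ∷ B ∷ C ∷ D ∷ Δ ∷ [])) ,
    ∣∣≡⇔slacks≡0 x₃ L 0≤P₂ 0≤P₄ (0≤1+4[+]+2Δ′ 0≤P₁ 0≤P₃)
        (solve (H ∷ A ∷ B ∷ C ∷ D ∷ Δ ∷ [])) (solve (H ∷ A ∷ B ∷ C ∷ D ∷ Δ ∷ []))
      ⟨⇔⟩ (σ₁-extremal ×-⇔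
           ⇔-both (≡⇔multiple≡0 (+ 2) P₄ gap-σe₂) (≡⇔multiple≡0 (- + 2) P₄ gap-σo₂))
      ⟨⇔⟩ ↔⇒⇔ (×-assoc _ _ _ _) ,
    ∣∣≡⇔slacks≡0 x₄ L 0≤P₂ 0≤P₃ (0≤1+4[+]+2Δ′ 0≤P₁ 0≤P₄)
        (solve (H ∷ A ∷ B ∷ C ∷ D ∷ Δ ∷ [])) (solve (H ∷ A ∷ B ∷ C ∷ D ∷ Δ ∷ []))
      ⟨⇔⟩ (σ₁-extremal ×-⇔
           ⇔-both (≡⇔multiple≡0 (- + 2) P₃ gap-σe₂′) (≡⇔multiple≡0 (+ 2) P₃ gap-σo₂′))
      ⟨⇔⟩ ↔⇒⇔ (×-assoc _ _ _ _)
    where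
    0≤4[+] : ∀ {U V} → 0ℤ ≤ U → 0ℤ ≤ V → 0ℤ ≤ + 4 * (U + V)
    0≤4[+] 0≤U 0≤V = nonneg-*ˡ 4 (nonneg-+ 0≤U 0≤V)
    0≤1+4[+]+2Δ′ : ∀ {U V} → 0ℤ ≤ U → 0ℤ ≤ V → 0ℤ ≤ + 1 + + 4 * (U + V) + + 2 * Δ′
    0≤1+4[+]+2Δ′ 0≤U 0≤V = nonneg-+ (nonneg-+ (+≤+ {n = 1} z≤n) (0≤4[+] 0≤U 0≤V)) (nonneg-*ˡ 2 0≤Δ′)
    gap-σe₁ : + 2 * A - (M - (L - L₂ + Δ)) ≡ + 2 * P₂
    gap-σe₁ = solve (H ∷ A ∷ B ∷ C ∷ D ∷ Δ ∷ [])
    gap-σo₁ : + 2 * B - M ≡ - + 2 * P₂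
    gap-σo₁ = solve (H ∷ A ∷ B ∷ C ∷ D ∷ Δ ∷ [])
    σ₁-extremal : (P₂ ≡ 0ℤ) ⇔ ((+ 2 * A ≡ M - (L - L₂ + Δ)) × (+ 2 * B ≡ M))
    σ₁-extremal = ⇔-both (≡⇔multiple≡0 (+ 2) P₂ gap-σe₁) (≡⇔multiple≡0 (- + 2) P₂ gap-σo₁)
    gap-σe₂ : + 2 * C - (M - L₂) ≡ + 2 * P₄
    gap-σe₂ = solve (H ∷ A ∷ B ∷ C ∷ D ∷ Δ ∷ [])
    gap-σo₂ : + 2 * D - M ≡ - + 2 * P₄
    gap-σo₂ = solve (H ∷ A ∷ B ∷ C ∷ D ∷ Δ ∷ [])
    gap-σe₂′ : + 2 * C - M ≡ - + 2 * P₃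
    gap-σe₂′ = solve (H ∷ A ∷ B ∷ C ∷ D ∷ Δ ∷ [])
    gap-σo₂′ : + 2 * D - (M - L₂) ≡ + 2 * P₃
    gap-σo₂′ = solve (H ∷ A ∷ B ∷ C ∷ D ∷ Δ ∷ [])

module CayleySubset (m′ : ℕ) (S : Subset {suc m′}) (cayley : IsCayley S) where

  open import Data.Bool using (_∧_; if_then_else_; T?)
  open import Data.Nat
  open import Data.Nat.Properties
  open import Data.Nat.DivMod using (_%_; m%n<n; m<n⇒m%n≡m; n%n≡0; m%n%n≡m%n; %-distribˡ-+; [m+n]%n≡m%n)
  open import Data.Nat.Tactic.RingSolver using (solve-∀)
  open import Data.Fin using (Fin; toℕ)
  import Data.Fin as Fin
  open import Data.Fin.Properties using (toℕ-injective; toℕ<n; toℕ-fromℕ<)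
  open import Data.List using (map; allFin; filterᵇ; length; _++_)
  open import Data.List.Properties using (map-tabulate; filter-++; length-++)
  open import Data.Product using (_×_; _,_)
  open import Function using (_∘_; id)
  open import Relation.Binary.PropositionalEquality
  open Counting

  open IsCayley cayley

  m : ℕ
  m = suc m′

  toℕ-md≡% : ∀ a → toℕ (md {m} a) ≡ a % (2 * m)
  toℕ-md≡% a = toℕ-fromℕ< (m%n<n a (2 * m))

  toℕ-md : ∀ {a} → a < 2 * m → toℕ (md {m} a) ≡ a
  toℕ-md {a} a<2m = trans (toℕ-md≡% a) (m<n⇒m%n≡m a<2m)

  md-toℕ : ∀ (i : Fin (2 * m)) → md (toℕ i) ≡ i
  md-toℕ i = toℕ-injective (toℕ-md (toℕ<n i))

  md-cong : ∀ a b → a % (2 * m) ≡ b % (2 * m) → md {m} a ≡ md b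
  md-cong a b a≡b = toℕ-injective (trans (toℕ-md≡% a) (trans a≡b (sym (toℕ-md≡% b))))

  inv-involutive : ∀ (g : Q m) → inv (inv g) ≡ g
  inv-involutive ⟨ false , Fin.zero ⟩ = cong ⟨ false ,_⟩ (md-cong (2 * m ∸ toℕ (md {m} (2 * m))) 0 (begin
    (2 * m ∸ toℕ (md {m} (2 * m))) % (2 * m)
      ≡⟨ cong (λ a → (2 * m ∸ a) % (2 * m)) (trans (toℕ-md≡% (2 * m)) (n%n≡0 (2 * m))) ⟩
    (2 * m) % (2 * m)
      ≡⟨ n%n≡0 (2 * m) ⟩
    0 ∎))
    where open ≡-Reasoning
  inv-involutive ⟨ false , a@(Fin.suc _) ⟩ = cong ⟨ false ,_⟩ (begin
    md (2 * m ∸ toℕ (md {m} (2 * m ∸ toℕ a)))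
      ≡⟨ cong (λ b → md (2 * m ∸ b)) (toℕ-md (∸-monoʳ-< {2 * m} (s≤s z≤n) (<⇒≤ (toℕ<n a)))) ⟩
    md (2 * m ∸ (2 * m ∸ toℕ a))
      ≡⟨ cong md (m∸[m∸n]≡n (<⇒≤ (toℕ<n a))) ⟩
    md (toℕ a)
      ≡⟨ md-toℕ a ⟩
    a ∎)
    where open ≡-Reasoning
  inv-involutive ⟨ true , a ⟩ = cong ⟨ true ,_⟩ (trans (md-cong (toℕ (md {m} (toℕ a + m)) + m) (toℕ a) (begin
    (toℕ (md {m} (toℕ a + m)) + m) % (2 * m)
      ≡⟨ cong (λ b → (b + m) % (2 * m)) (toℕ-md≡% (toℕ a + m)) ⟩
    ((toℕ a + m) % (2 * m) + m) % (2 * m)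
      ≡⟨ %-distribˡ-+ ((toℕ a + m) % (2 * m)) m (2 * m) ⟩
    ((toℕ a + m) % (2 * m) % (2 * m) + m % (2 * m)) % (2 * m)
      ≡⟨ cong (λ b → (b + m % (2 * m)) % (2 * m)) (m%n%n≡m%n (toℕ a + m) (2 * m)) ⟩
    ((toℕ a + m) % (2 * m) + m % (2 * m)) % (2 * m)
      ≡⟨ %-distribˡ-+ (toℕ a + m) m (2 * m) ⟨
    (toℕ a + m + m) % (2 * m)
      ≡⟨ cong (_% (2 * m)) (trans (+-assoc (toℕ a) m m) (cong (λ b → toℕ a + (m + b)) (sym (+-identityʳ m)))) ⟩
    (toℕ a + 2 * m) % (2 * m)
      ≡⟨ [m+n]%n≡m%n (toℕ a) (2 * m) ⟩
    toℕ a % (2 * m) ∎)) (md-toℕ a))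
    where open ≡-Reasoning

  S∘inv≡S : ∀ g → S (inv g) ≡ S g
  S∘inv≡S g with S g in Sg | S (inv g) in S[g⁻¹]
  ... | true  | true  = refl
  ... | false | false = refl
  ... | true  | false = trans (sym S[g⁻¹]) (symmetric g Sg)
  ... | false | true  = trans (sym (subst (λ h → S h ≡ true) (inv-involutive g) (symmetric (inv g) S[g⁻¹]))) Sg

  Sx Sxy : ℕ → Bool
  Sx  k = S (xpow k)
  Sxy k = S (xpowy k)

  Sx-reflect : ∀ {j} → j < 2 * m → Sx (2 * m ∸ j) ≡ Sx j
  Sx-reflect {j} j<2m = trans (cong (λ a → Sx (2 * m ∸ a)) (sym (toℕ-md j<2m))) (S∘inv≡S (xpow j))

  Sxy-shift : ∀ {k} → k < 2 * m → Sxy (k + m) ≡ Sxy k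
  Sxy-shift {k} k<2m = trans (cong (λ a → Sxy (a + m)) (sym (toℕ-md k<2m))) (S∘inv≡S (xpowy k))

  σ₁-sum : σe₁ S + σo₁ S ≡ count (Sx ∘ suc) m′
  σ₁-sum = trans (cong₂ _+_ (length-filterᵇ-map-upTo (λ k → isEven k ∧ Sx k) suc m′)
                            (length-filterᵇ-map-upTo (λ k → isOdd k ∧ Sx k) suc m′))
                 (count-∧-split m′ (isEven ∘ suc) (Sx ∘ suc))

  σ₂-sum : σe₂ S + σo₂ S ≡ count Sxy m
  σ₂-sum = trans (cong₂ _+_ (length-filterᵇ-applyUpTo (λ k → isEven k ∧ Sxy k) id m)
                            (length-filterᵇ-applyUpTo (λ k → isOdd k ∧ Sxy k) id m))
                 (count-∧-split m isEven Sxy)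

  -- For k < m′, x^(m+1+k) is the inverse of x^(m′-k): the upper half of ⟨x⟩ ∖ {1, x^m} mirrors the lower one.
  Sx-upper-half : count (λ k → Sx (suc (m′ + suc k))) m′ ≡ count (Sx ∘ suc) m′
  Sx-upper-half = trans (count-reverse m′ _) (count-cong m′ λ k k<m′ →
    trans (cong Sx (sym (2m∸[1+k]≡ k<m′))) (Sx-reflect (<-≤-trans (s<s k<m′) (m≤m+n m (m + 0)))))
    where
    2m∸[1+k]≡ : ∀ {k} → k < m′ → 2 * m ∸ suc k ≡ suc (m′ + suc (m′ ∸ suc k))
    2m∸[1+k]≡ {k} k<m′ = trans (cong (_∸ suc k) 2m≡) (m+n∸m≡n (suc k) _)
      where
      split : ∀ k j → 2 * suc (suc k + j) ≡ suc k + suc (suc k + j + suc j)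
      split = solve-∀
      2m≡ : 2 * m ≡ suc k + suc (m′ + suc (m′ ∸ suc k))
      2m≡ = subst (λ t → 2 * suc t ≡ suc k + suc (t + suc (m′ ∸ suc k))) (m+[n∸m]≡n k<m′) (split k (m′ ∸ suc k))

  cardSx-value : cardSx S ≡ δ S + 2 * (σe₁ S + σo₁ S)
  cardSx-value = begin
    cardSx S
      ≡⟨ length-filterᵇ-map-upTo S xpow (2 * m) ⟩
    count Sx (2 * m)
      ≡⟨ cong (λ t → count Sx (suc (m′ + t))) (+-identityʳ m) ⟩
    indicator (Sx 0) + count (Sx ∘ suc) (m′ + m)
      ≡⟨ cong₂ _+_ (cong indicator no-identity) (count-+ m′ m (Sx ∘ suc)) ⟩
    count (Sx ∘ suc) m′ + (indicator (Sx (suc (m′ + 0))) + count (λ k → Sx (suc (m′ + suc k))) m′)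
      ≡⟨ cong₂ (λ t c → count (Sx ∘ suc) m′ + (indicator (Sx (suc t)) + c)) (+-identityʳ m′) Sx-upper-half ⟩
    count (Sx ∘ suc) m′ + (δ S + count (Sx ∘ suc) m′)
      ≡⟨ c+[d+c]≡d+2c (count (Sx ∘ suc) m′) (δ S) ⟩
    δ S + 2 * count (Sx ∘ suc) m′
      ≡⟨ cong (λ c → δ S + 2 * c) σ₁-sum ⟨
    δ S + 2 * (σe₁ S + σo₁ S)
      ∎
    where
    open ≡-Reasoning
    c+[d+c]≡d+2c : ∀ c d → c + (d + c) ≡ d + 2 * c
    c+[d+c]≡d+2c = solve-∀

  cardSxy-value : cardSxy S ≡ 2 * (σe₂ S + σo₂ S)
  cardSxy-value = begin
    cardSxy S
      ≡⟨ length-filterᵇ-map-upTo S xpowy (2 * m) ⟩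
    count Sxy (2 * m)
      ≡⟨ cong (λ t → count Sxy (m + t)) (+-identityʳ m) ⟩
    count Sxy (m + m)
      ≡⟨ count-+ m m Sxy ⟩
    count Sxy m + count (λ k → Sxy (m + k)) m
      ≡⟨ cong (count Sxy m +_) (count-cong m λ k k<m →
           trans (cong Sxy (+-comm m k)) (Sxy-shift (<-≤-trans k<m (m≤m+n m (m + 0))))) ⟩
    count Sxy m + count Sxy m
      ≡⟨ cong (count Sxy m +_) (+-identityʳ (count Sxy m)) ⟨
    2 * count Sxy m
      ≡⟨ cong (2 *_) σ₂-sum ⟨
    2 * (σe₂ S + σo₂ S)
      ∎
    where open ≡-Reasoning

  length-filterᵇ-coset : ∀ e (q : ℕ → Bool) → (∀ k → q k ≡ S ⟨ e , md k ⟩) →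
                         length (filterᵇ S (map ⟨ e ,_⟩ (allFin (2 * m)))) ≡ count q (2 * m)
  length-filterᵇ-coset e q q≡ = trans (cong (length ∘ filterᵇ S) (map-tabulate id ⟨ e ,_⟩))
    (length-filterᵇ-tabulate S ⟨ e ,_⟩ q λ i →
      trans (cong (λ j → S ⟨ e , j ⟩) (sym (md-toℕ i))) (sym (q≡ (toℕ i))))

  cardS-value : cardS S ≡ cardSx S + cardSxy S
  cardS-value = begin
    cardS S
      ≡⟨ cong length (filter-++ (T? ∘ S) (map ⟨ false ,_⟩ (allFin (2 * m))) _) ⟩
    length (filterᵇ S (map ⟨ false ,_⟩ (allFin (2 * m))) ++ filterᵇ S (map ⟨ true ,_⟩ (allFin (2 * m))))
      ≡⟨ length-++ (filterᵇ S (map ⟨ false ,_⟩ (allFin (2 * m)))) ⟩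
    length (filterᵇ S (map ⟨ false ,_⟩ (allFin (2 * m)))) + length (filterᵇ S (map ⟨ true ,_⟩ (allFin (2 * m))))
      ≡⟨ cong₂ _+_ (length-filterᵇ-coset false Sx (λ _ → refl)) (length-filterᵇ-coset true Sxy (λ _ → refl)) ⟩
    count Sx (2 * m) + count Sxy (2 * m)
      ≡⟨ cong₂ _+_ (length-filterᵇ-map-upTo S xpow (2 * m)) (length-filterᵇ-map-upTo S xpowy (2 * m)) ⟨
    cardSx S + cardSxy S
      ∎
    where open ≡-Reasoning

  cardSx≤ : cardSx S ≤ 2 * m
  cardSx≤ = ≤-trans (≤-reflexive (length-filterᵇ-map-upTo S xpow (2 * m))) (count≤ (2 * m) Sx)

  cardSxy≤ : cardSxy S ≤ 2 * m
  cardSxy≤ = ≤-trans (≤-reflexive (length-filterᵇ-map-upTo S xpowy (2 * m))) (count≤ (2 * m) Sxy)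

  cardS≤ : cardS S ≤ 4 * m
  cardS≤ = ≤-trans (≤-reflexive cardS-value) (≤-trans (+-mono-≤ cardSx≤ cardSxy≤) (≤-reflexive (2n+2n≡4n m)))
    where
    2n+2n≡4n : ∀ n → 2 * n + 2 * n ≡ 4 * n
    2n+2n≡4n = solve-∀

  σe₁-bound : suc (σe₁ S) ≤ ⌈ m /2⌉
  σe₁-bound = ≤-trans (s≤s (≤-trans (≤-reflexive (length-filterᵇ-map-upTo (λ k → isEven k ∧ Sx k) suc m′))
                                    (count-∧≤ m′ (isEven ∘ suc) (Sx ∘ suc))))
                      (≤-reflexive (count-isEven m))

  σo₁-bound : σo₁ S ≤ ⌊ m /2⌋
  σo₁-bound = ≤-trans (≤-trans (≤-reflexive (length-filterᵇ-map-upTo (λ k → isOdd k ∧ Sx k) suc m′))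
                               (count-∧≤ m′ (isOdd ∘ suc) (Sx ∘ suc)))
                      (≤-reflexive (count-isOdd m))

  σe₂-bound : σe₂ S ≤ ⌈ m /2⌉
  σe₂-bound = ≤-trans (≤-trans (≤-reflexive (length-filterᵇ-applyUpTo (λ k → isEven k ∧ Sxy k) id m))
                               (count-∧≤ m isEven Sxy))
                      (≤-reflexive (count-isEven m))

  σo₂-bound : σo₂ S ≤ ⌊ m /2⌋
  σo₂-bound = ≤-trans (≤-trans (≤-reflexive (length-filterᵇ-applyUpTo (λ k → isOdd k ∧ Sxy k) id m))
                               (count-∧≤ m isOdd Sxy))
                      (≤-reflexive (count-isOdd m))

  δ-parity : δ S ≡ (if isEven (l S) then 0 else 1)
  δ-parity = indicator-parity (l S) (Sx m) (begin
    isEven (l S + δ S)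
      ≡⟨ isEven-+-2* (l S + δ S) (σe₁ S + σo₁ S + (σe₂ S + σo₂ S)) ⟨
    isEven (l S + δ S + 2 * (σe₁ S + σo₁ S + (σe₂ S + σo₂ S)))
      ≡⟨ cong isEven (regroup (l S) (δ S) (σe₁ S + σo₁ S) (σe₂ S + σo₂ S)) ⟩
    isEven (l S + (δ S + 2 * (σe₁ S + σo₁ S) + 2 * (σe₂ S + σo₂ S)))
      ≡⟨ cong (λ c → isEven (l S + c)) (trans cardS-value (cong₂ _+_ cardSx-value cardSxy-value)) ⟨
    isEven (l S + cardS S)
      ≡⟨ cong isEven (m∸n+n≡m cardS≤) ⟩
    isEven (4 * m)
      ≡⟨ cong isEven (4n≡0+2[2n] m) ⟩
    isEven (0 + 2 * (2 * m))
      ≡⟨ isEven-+-2* 0 (2 * m) ⟩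
    true
      ∎)
    where
    open ≡-Reasoning
    regroup : ∀ l d x y → l + d + 2 * (x + y) ≡ l + (d + 2 * x + 2 * y)
    regroup = solve-∀
    4n≡0+2[2n] : ∀ n → 4 * n ≡ 0 + 2 * (2 * n)
    4n≡0+2[2n] = solve-∀

  δ≤1 : δ S ≤ 1
  δ≤1 = indicator≤1 (Sx m)

  odd-bounds : isEven m ≡ false → m ≡ suc (⌊ m /2⌋ + ⌊ m /2⌋) × σe₁ S ≤ ⌊ m /2⌋ × σo₁ S ≤ ⌊ m /2⌋
  odd-bounds m-odd with m≡ , ⌈m/2⌉≡ ← odd-halves m m-odd =
    m≡ , s≤s⁻¹ (≤-trans σe₁-bound (≤-reflexive ⌈m/2⌉≡)) , σo₁-bound

  even-bounds : isEven m ≡ true → m ≡ ⌊ m /2⌋ + ⌊ m /2⌋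
    × suc (σe₁ S) ≤ ⌊ m /2⌋ × σo₁ S ≤ ⌊ m /2⌋ × σe₂ S ≤ ⌊ m /2⌋ × σo₂ S ≤ ⌊ m /2⌋
  even-bounds m-even with m≡ , ⌈m/2⌉≡ ← even-halves m m-even =
    m≡ , ≤-trans σe₁-bound (≤-reflexive ⌈m/2⌉≡) , σo₁-bound ,
    ≤-trans σe₂-bound (≤-reflexive ⌈m/2⌉≡) , σo₂-bound

open import Data.Nat using (NonZero; zero; z≤n; ⌊_/2⌋)
open import Data.Bool using (if_then_else_)
open import Data.Integer using (ℤ; +_; -_; _+_; _-_; _*_; _≤_; ∣_∣; 0ℤ; +≤+)
open import Data.Integer.Properties using (pos-*)
open import Data.Product using (_×_; _,_; proj₁; proj₂)
open import Data.Sum using (_⊎_)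
open import Function.Bundles using (_⇔_)
open import Relation.Binary.PropositionalEquality using (_≡_; refl; trans; sym; cong; cong₂)
open IntegerSlack using (+-∸)
open ExtremalValues

if-false : ∀ {A : Set} {b} {x y : A} → b ≡ false → (if b then x else y) ≡ y
if-false refl = refl

if-true : ∀ {A : Set} {b} {x y : A} → b ≡ true → (if b then x else y) ≡ x
if-true refl = refl

module CayleyEigenvalues (m′ : ℕ) (S : Subset {suc m′}) (cayley : IsCayley S) where

  open CayleySubset m′ S cayley

  A B C D H : ℤ
  A = + σe₁ S
  B = + σo₁ S
  C = + σe₂ S
  D = + σo₂ S
  H = + ⌊ m /2⌋

  l₂-value : + l₂ S ≡ + 2 * + m - + 2 * (C + D)
  l₂-value = trans (+-∸ cardSxy≤) (cong₂ _-_ (pos-* 2 m) (trans (cong +_ cardSxy-value) (pos-* 2 (σe₂ S Data.Nat.+ σo₂ S))))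

  l-value : + l S ≡ + 4 * + m - (+ δ S + + 2 * (A + B) + + 2 * (C + D))
  l-value = trans (+-∸ cardS≤) (cong₂ _-_ (pos-* 4 m)
    (trans (cong +_ (trans cardS-value (cong₂ Data.Nat._+_ cardSx-value cardSxy-value)))
           (cong₂ (λ u v → + δ S + u + v) (pos-* 2 (σe₁ S Data.Nat.+ σo₁ S)) (pos-* 2 (σe₂ S Data.Nat.+ σo₂ S)))))

  δ-from-parity : ∀ {b} → isEven (l S) ≡ b → + δ S ≡ + (if b then 0 else 1)
  δ-from-parity refl = cong +_ δ-parity

  m-odd-halves : isEven m ≡ false → + m ≡ + 1 + (H + H)
  m-odd-halves m-odd = cong +_ (proj₁ (odd-bounds m-odd))

  m-even-halves : isEven m ≡ true → + m ≡ H + H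
  m-even-halves m-even = cong +_ (proj₁ (even-bounds m-even))

  λ₁-value : λ₁ S ≡ + (4 Data.Nat.* m) - + l S
  λ₁-value = trans (proj₁ (λ₁λ₂-values (+ 2 * (A + B)) (+ m) l₂-value l-value)) (cong (_- + l S) (sym (pos-* 4 m)))

  λ₂-value : λ₂ S ≡ - + l S + + 2 * + l₂ S
  λ₂-value = proj₂ (λ₁λ₂-values (+ 2 * (A + B)) (+ m) l₂-value l-value)

  λ₃-odd : isEven m ≡ false → λ₃ S ≡ + 2 * (A - B) - + δ S
  λ₃-odd = if-false

  λ₄-odd : isEven m ≡ false → λ₄ S ≡ + 2 * (A - B) - + δ S
  λ₄-odd = if-false

  λ₃-even : isEven m ≡ true → λ₃ S ≡ + 2 * (A - B) + + δ S + + 2 * (C - D)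
  λ₃-even = if-true

  λ₄-even : isEven m ≡ true → λ₄ S ≡ + 2 * (A - B) + + δ S - + 2 * (C - D)
  λ₄-even = if-true

lemma3p2 : (m : ℕ) .{{_ : NonZero m}} (S : Subset {m}) → IsCayley S →
    (λ₁ S ≡ + (4 Data.Nat.* m) - + l S)
    × (λ₂ S ≡ - + l S + + 2 * + l₂ S)
    × (isEven m ≡ false →
        (isEven (l S) ≡ false →
            (- (+ l S - + l₂ S) ≤ λ₃ S) × (λ₃ S ≡ λ₄ S) × (λ₃ S ≤ + l S - + l₂ S - + 2)
          × ((+ ∣ λ₃ S ∣ ≡ + l S - + l₂ S) ⇔
              ((+ 2 * + σe₁ S ≡ (+ m + + 1) - (+ l S - + l₂ S + + 1))
                × (+ 2 * + σo₁ S ≡ + m - + 1))))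
      × (isEven (l S) ≡ true →
            (- (+ l S - + l₂ S - + 2) ≤ λ₃ S) × (λ₃ S ≡ λ₄ S) × (λ₃ S ≤ + l S - + l₂ S - + 2)
          × ((+ ∣ λ₃ S ∣ ≡ + l S - + l₂ S - + 2) ⇔
              (((+ 2 * + σe₁ S ≡ (+ m + + 1) - (+ l S - + l₂ S))
                 × (+ 2 * + σo₁ S ≡ + m - + 1))
               ⊎ ((+ 2 * + σe₁ S ≡ + m - + 1)
                 × (+ 2 * + σo₁ S ≡ (+ m + + 1) - (+ l S - + l₂ S)))))))
    × (isEven m ≡ true →
        (- + l S ≤ λ₃ S) × (λ₃ S ≤ + l S + + 2 * + δ S - + 4)
      × (- + l S ≤ λ₄ S) × (λ₄ S ≤ + l S + + 2 * + δ S - + 4)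
      × ((+ ∣ λ₃ S ∣ ≡ + l S) ⇔
          ((+ 2 * + σe₁ S ≡ + m - (+ l S - + l₂ S + + δ S))
            × (+ 2 * + σo₁ S ≡ + m)
            × (+ 2 * + σe₂ S ≡ + m - + l₂ S)
            × (+ 2 * + σo₂ S ≡ + m)))
      × ((+ ∣ λ₄ S ∣ ≡ + l S) ⇔
          ((+ 2 * + σe₁ S ≡ + m - (+ l S - + l₂ S + + δ S))
            × (+ 2 * + σo₁ S ≡ + m)
            × (+ 2 * + σe₂ S ≡ + m)
            × (+ 2 * + σo₂ S ≡ + m - + l₂ S))))
lemma3p2 zero {{()}}
lemma3p2 (suc m′) S cayley =
  λ₁-value , λ₂-value ,
  (λ m-odd → let _ , σe₁≤h , σo₁≤h = odd-bounds m-odd in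
     (λ l-odd → extremes-odd-m-odd-l A B H (δ-from-parity l-odd) (m-odd-halves m-odd) (+-∸ σe₁≤h) (+-∸ σo₁≤h)
                  l₂-value l-value (λ₃-odd m-odd) (λ₄-odd m-odd) 0≤+ 0≤+) ,
     (λ l-even → extremes-odd-m-even-l A B H (δ-from-parity l-even) (m-odd-halves m-odd) (+-∸ σe₁≤h) (+-∸ σo₁≤h)
                   l₂-value l-value (λ₃-odd m-odd) (λ₄-odd m-odd) 0≤+ 0≤+)) ,
  (λ m-even → let _ , σe₁<h , σo₁≤h , σe₂≤h , σo₂≤h = even-bounds m-even in
     extremes-even-m A B C D H (+-∸ δ≤1) (m-even-halves m-even)
       (+-∸ σe₁<h) (+-∸ σo₁≤h) (+-∸ σe₂≤h) (+-∸ σo₂≤h)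
       l₂-value l-value (λ₃-even m-even) (λ₄-even m-even) 0≤+ 0≤+ 0≤+ 0≤+ 0≤+)
  where
  open CayleySubset m′ S cayley
  open CayleyEigenvalues m′ S cayley
  0≤+ : ∀ {k} → 0ℤ ≤ + k
  0≤+ = +≤+ z≤n
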